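{- Each terminating TRS is an EPRF-TRS.
   Context: A ranked alphabet is a finite set of symbols with ranks; $X$ a countable set of variables, $T_\Sigma(X)$ the terms, $T_\Sigma$ the ground terms. A TRS $R$ is a finite set of rules $l\to r$, $l,r\in T_\Sigma(X)$, with every variable of $r$ occurring in $l$; $sign(R)$ is the set of symbols in its rules; $R$ is terminating if there is no infinite rewrite sequence. $R^*_\Sigma(L)=\{p\mid q\Rightarrow^*_R p,\ q\in L\}$. A bottom-up tree automaton (bta) over $\Sigma$ is a finite automaton with states (treated as constants), final states, rules $\delta(a_1,\dots,a_n)\to a$ and $a\to a'$, recognizing the ground terms rewriting to a final state. $R$ is an EPRF-TRS if for any given ranked alphabet $\Sigma\supseteq sign(R)$ and finite $L\subseteq T_\Sigma$ one can effectively construct a bta $\mathcal{C}$ over $\Sigma$ with $L(\mathcal{C})=R^*_\Sigma(L)$. -}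

module Defs where

open import Data.Nat using (ℕ)
open import Data.Fin using (Fin)
open import Data.Empty using (⊥)
open import Data.Product using (Σ; _×_; _,_; proj₁; proj₂; ∃)
open import Data.List using (List; []; _∷_; _++_)
open import Data.List.Membership.Propositional using (_∈_)
open import Data.List.Relation.Unary.All using (All)
open import Data.List.Relation.Unary.Any using (Any)
open import Data.Vec using (Vec; []; _∷_)
open import Relation.Binary.PropositionalEquality using (_≡_)
open import Relation.Binary.Construct.Closure.ReflexiveTransitive using (Star)
open import Induction.WellFounded using (WellFounded)
open import Function.Bundles using (_⇔_)

-- Symbols.  A symbol is a pair (name , rank); a ranked alphabet is a
-- finite set of symbols, represented as a list.

Sym : Set
Sym = ℕ × ℕ

rank : Sym → ℕ
rank = proj₂

RankedAlphabet : Set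
RankedAlphabet = List Sym

-- Terms over the (countable) universe of symbols, variables X = ℕ,
-- and additionally constants drawn from Q (used for automaton states).

data Tm (Q : Set) : Set where
  var : ℕ → Tm Q
  st  : Q → Tm Q
  app : (f : Sym) → Vec (Tm Q) (rank f) → Tm Q

Term : Set
Term = Tm ⊥

mutual
  vars : ∀ {Q} → Tm Q → List ℕ
  vars (var x)   = x ∷ []
  vars (st q)    = []
  vars (app f ts) = varsV ts

  varsV : ∀ {Q n} → Vec (Tm Q) n → List ℕ
  varsV []       = []
  varsV (t ∷ ts) = vars t ++ varsV ts

mutual
  syms : ∀ {Q} → Tm Q → List Sym
  syms (var x)    = []
  syms (st q)     = []
  syms (app f ts) = f ∷ symsV ts

  symsV : ∀ {Q n} → Vec (Tm Q) n → List Sym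
  symsV []       = []
  symsV (t ∷ ts) = syms t ++ symsV ts

GroundOver : RankedAlphabet → Term → Set
GroundOver Σ' t = (vars t ≡ []) × (∀ f → f ∈ syms t → f ∈ Σ')

mutual
  ι : ∀ {Q} → Term → Tm Q
  ι (var x)    = var x
  ι (st ())
  ι (app f ts) = app f (ιV ts)

  ιV : ∀ {Q n} → Vec Term n → Vec (Tm Q) n
  ιV []       = []
  ιV (t ∷ ts) = ι t ∷ ιV ts

mutual
  subst : (ℕ → Term) → Term → Term
  subst σ (var x)    = σ x
  subst σ (st ())
  subst σ (app f ts) = app f (substV σ ts)

  substV : ∀ {n} → (ℕ → Term) → Vec Term n → Vec Term n
  substV σ []       = []
  substV σ (t ∷ ts) = subst σ t ∷ substV σ ts

Rule : Set
Rule = Term × Term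

record TRS : Set where
  field
    rules   : List Rule
    varCond : All (λ lr → ∀ x → x ∈ vars (proj₂ lr) → x ∈ vars (proj₁ lr)) rules
open TRS public

signRules : List Rule → List Sym
signRules []             = []
signRules ((l , r) ∷ rs) = syms l ++ syms r ++ signRules rs

sign : TRS → List Sym
sign R = signRules (rules R)

mutual
  data Step (R : TRS) : Term → Term → Set where
    root : ∀ {l r} (σ : ℕ → Term) → (l , r) ∈ rules R →
           Step R (subst σ l) (subst σ r)
    arg  : ∀ f {ts us : Vec Term (rank f)} → StepV R ts us →
           Step R (app f ts) (app f us)

  data StepV (R : TRS) : ∀ {n} → Vec Term n → Vec Term n → Set where
    here  : ∀ {n t u} {ts : Vec Term n} → Step R t u → StepV R (t ∷ ts) (u ∷ ts)
    there : ∀ {n t} {ts us : Vec Term n} → StepV R ts us → StepV R (t ∷ ts) (t ∷ us)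

Steps : TRS → Term → Term → Set
Steps R = Star (Step R)

-- R terminating: no infinite rewrite sequence, stated constructively as
-- well-foundedness of the converse of ⇒_R (on all terms).
Terminating : TRS → Set
Terminating R = WellFounded (λ u t → Step R t u)

Descendants : TRS → List Term → Term → Set
Descendants R L p = ∃ λ q → q ∈ L × Steps R q p

DeltaRule : ℕ → Set
DeltaRule n = Σ Sym (λ f → Vec (Fin n) (rank f) × Fin n)

record BTA (Σ' : RankedAlphabet) : Set where
  field
    nstates  : ℕ
    final    : List (Fin nstates)
    δrules   : List (DeltaRule nstates)
    δinΣ     : All (λ d → proj₁ d ∈ Σ') δrules
    εrules   : List (Fin nstates × Fin nstates)
open BTA public

stV : ∀ {Q n} → Vec Q n → Vec (Tm Q) n
stV []       = []
stV (q ∷ qs) = st q ∷ stV qs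

-- one move of the automaton (a rewrite step with its rules, states as constants)
mutual
  data Move {Σ' : RankedAlphabet} (C : BTA Σ') : Tm (Fin (nstates C)) → Tm (Fin (nstates C)) → Set where
    δmove : ∀ {f qs q} → (f , qs , q) ∈ δrules C → Move C (app f (stV qs)) (st q)
    εmove : ∀ {a a'} → (a , a') ∈ εrules C → Move C (st a) (st a')
    arg   : ∀ f {ts us : Vec (Tm (Fin (nstates C))) (rank f)} → MoveV C ts us →
            Move C (app f ts) (app f us)

  data MoveV {Σ' : RankedAlphabet} (C : BTA Σ') : ∀ {n} → Vec (Tm (Fin (nstates C))) n → Vec (Tm (Fin (nstates C))) n → Set where
    here  : ∀ {n t u} {ts : Vec (Tm (Fin (nstates C))) n} → Move C t u → MoveV C (t ∷ ts) (u ∷ ts)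
    there : ∀ {n t} {ts us : Vec (Tm (Fin (nstates C))) n} → MoveV C ts us → MoveV C (t ∷ ts) (t ∷ us)

Lang : ∀ {Σ'} → BTA Σ' → Term → Set
Lang {Σ'} C t = GroundOver Σ' t × (∃ λ q → q ∈ final C × Star (Move C) (ι t) (st q))

-- EPRF-TRS: for every ranked alphabet Σ ⊇ sign(R) and finite L ⊆ T_Σ one
-- can effectively (= by a function) construct a bta C with L(C) = R*_Σ(L).

EPRF : TRS → Set
EPRF R = (Σ' : RankedAlphabet) → (∀ f → f ∈ sign R → f ∈ Σ') →
         (L : List Term) → All (GroundOver Σ') L →
         Σ (BTA Σ') (λ C → ∀ t → Lang C t ⇔ Descendants R L t)

-- The proof has three independent parts.
-- (1) R is effectively finitely branching: the one-step successors of a term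
--     form a computable finite list.  At the root they are found by syntactic
--     matching of the left-hand sides, below the root by recursion.
-- (2) A constructive König lemma: for a finitely branching relation whose
--     converse is well founded, everything reachable from a finite set of
--     starting points is a computable finite list.  Termination of R is
--     exactly this well-foundedness, so R*_Σ(L) is a finite list D.
-- (3) Rewriting keeps ground terms over Σ ground over Σ (since Σ ⊇ sign(R)
--     and var(r) ⊆ var(l)), so D ⊆ T_Σ; and every finite set of ground terms
--     over Σ is recognised by a bta whose states are the subterms of the set,
--     with a rule f(s₁,…,sₙ) → f(s₁,…,sₙ) for each subterm and the elements of
--     the set as final states.
-- The theorem is (3) applied to the list D produced by (1) and (2).

module Submission where

open import Defs
open import Data.Nat as ℕ using (ℕ)
open import Data.Fin using (Fin)
open import Data.Empty using (⊥-elim)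
open import Data.Product using (Σ; _×_; _,_; proj₁; proj₂; ∃)
open import Data.Product.Properties using (≡-dec)
open import Data.Sum using (inj₁; inj₂)
open import Data.Maybe using (Maybe; just; nothing)
open import Data.List using (List; []; _∷_; _++_; map; concat; concatMap; filter; allFin; lookup; length)
open import Data.List.Properties using (++-conicalˡ; ++-conicalʳ)
open import Data.List.Membership.Propositional using (_∈_; find; mapWith∈)
open import Data.List.Membership.Propositional.Properties using (∈-map⁺; ∈-map⁻; ∈-++⁺ˡ; ∈-++⁺ʳ; ∈-++⁻; ∈-concatMap⁺; ∈-concatMap⁻; ∈-filter⁺; ∈-filter⁻; ∈-allFin)
open import Data.List.Relation.Unary.All as All using (All; []; _∷_)
import Data.List.Relation.Unary.All.Properties as AllP
open import Data.List.Relation.Unary.Any as Any using (Any; here; there)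
import Data.List.Relation.Unary.Any.Properties as AnyP
open import Data.Vec using (Vec; []; _∷_)
open import Relation.Binary.PropositionalEquality using (_≡_; refl; sym; trans; cong; cong₂) renaming (subst to substEq)
open import Relation.Binary.Construct.Closure.ReflexiveTransitive using (Star; ε; _◅_; gmap; _◅◅_)
open import Relation.Nullary using (Dec; yes; no)
open import Induction.WellFounded using (WellFounded; Acc; acc)
open import Function using (flip)
open import Function.Bundles using (_⇔_; mk⇔; Equivalence)
open import Function.Properties.Equivalence using () renaming (trans to ⇔-trans)

_≟S_ : (f g : Sym) → Dec (f ≡ g)
_≟S_ = ≡-dec ℕ._≟_ ℕ._≟_

mutual
  _≟T_ : (t u : Term) → Dec (t ≡ u)
  var x ≟T var y with x ℕ.≟ y
  ... | yes refl = yes refl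
  ... | no x≢y = no λ { refl → x≢y refl }
  var x ≟T app g us = no λ ()
  app f ts ≟T var y = no λ ()
  app f ts ≟T app g us with f ≟S g
  ... | no f≢g = no λ { refl → f≢g refl }
  ... | yes refl with ts ≟V us
  ...   | yes refl = yes refl
  ...   | no ts≢us = no λ { refl → ts≢us refl }
  st () ≟T _
  var _ ≟T st ()
  app _ _ ≟T st ()

  _≟V_ : ∀ {n} (ts us : Vec Term n) → Dec (ts ≡ us)
  [] ≟V [] = yes refl
  (t ∷ ts) ≟V (u ∷ us) with t ≟T u | ts ≟V us
  ... | yes refl | yes refl = yes refl
  ... | no t≢u   | _        = no λ { refl → t≢u refl }
  ... | _        | no ts≢us = no λ { refl → ts≢us refl }

mutual
  subst-agree : ∀ (σ τ : ℕ → Term) t → (∀ x → x ∈ vars t → σ x ≡ τ x) → subst σ t ≡ subst τ t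
  subst-agree σ τ (var x) h = h x (here refl)
  subst-agree σ τ (st ()) h
  subst-agree σ τ (app f ts) h = cong (app f) (substV-agree σ τ ts h)

  substV-agree : ∀ {n} σ τ (ts : Vec Term n) → (∀ x → x ∈ varsV ts → σ x ≡ τ x) → substV σ ts ≡ substV τ ts
  substV-agree σ τ [] h = refl
  substV-agree σ τ (t ∷ ts) h =
    cong₂ _∷_ (subst-agree σ τ t (λ x m → h x (∈-++⁺ˡ m)))
              (substV-agree σ τ ts (λ x m → h x (∈-++⁺ʳ (vars t) m)))

mutual
  bindings : Term → Term → List (ℕ × Term)
  bindings (var x) t = (x , t) ∷ []
  bindings (st ()) t
  bindings (app f ls) (app g ts) = bindingsV ls ts
  bindings (app f ls) _ = []

  bindingsV : ∀ {n m} → Vec Term n → Vec Term m → List (ℕ × Term)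
  bindingsV (l ∷ ls) (t ∷ ts) = bindings l t ++ bindingsV ls ts
  bindingsV _ _ = []

substOf : List (ℕ × Term) → ℕ → Term
substOf [] x = var x
substOf ((y , s) ∷ bs) x with y ℕ.≟ x
... | yes _ = s
... | no _ = substOf bs x

-- Candidate matcher of l against t; t is an instance of l iff it is the
-- instance of l under this substitution.
matcher : Term → Term → ℕ → Term
matcher l t = substOf (bindings l t)

Agrees : (ℕ → Term) → List (ℕ × Term) → Set
Agrees σ bs = All (λ b → σ (proj₁ b) ≡ proj₂ b) bs

Binds : ℕ → List (ℕ × Term) → Set
Binds x bs = Any (λ b → proj₁ b ≡ x) bs

substOf-agrees : ∀ σ bs x → Agrees σ bs → Binds x bs → substOf bs x ≡ σ x
substOf-agrees σ ((y , s) ∷ bs) x (σy≡s ∷ _) _ with y ℕ.≟ x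
... | yes refl = sym σy≡s
substOf-agrees σ ((y , s) ∷ bs) x _ (here y≡x) | no y≢x = ⊥-elim (y≢x y≡x)
substOf-agrees σ ((y , s) ∷ bs) x (_ ∷ ag) (there b) | no _ = substOf-agrees σ bs x ag b

mutual
  bindings-agree : ∀ σ l → Agrees σ (bindings l (subst σ l))
  bindings-agree σ (var x) = refl ∷ []
  bindings-agree σ (st ())
  bindings-agree σ (app f ls) = bindingsV-agree σ ls

  bindingsV-agree : ∀ {n} σ (ls : Vec Term n) → Agrees σ (bindingsV ls (substV σ ls))
  bindingsV-agree σ [] = []
  bindingsV-agree σ (l ∷ ls) = AllP.++⁺ (bindings-agree σ l) (bindingsV-agree σ ls)

mutual
  bindings-cover : ∀ σ l x → x ∈ vars l → Binds x (bindings l (subst σ l))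
  bindings-cover σ (var y) x (here x≡y) = here (sym x≡y)
  bindings-cover σ (st ())
  bindings-cover σ (app f ls) x m = bindingsV-cover σ ls x m

  bindingsV-cover : ∀ {n} σ (ls : Vec Term n) x → x ∈ varsV ls → Binds x (bindingsV ls (substV σ ls))
  bindingsV-cover σ (l ∷ ls) x m with ∈-++⁻ (vars l) m
  ... | inj₁ m' = AnyP.++⁺ˡ (bindings-cover σ l x m')
  ... | inj₂ m' = AnyP.++⁺ʳ (bindings l (subst σ l)) (bindingsV-cover σ ls x m')

matcher-correct : ∀ σ l x → x ∈ vars l → matcher l (subst σ l) x ≡ σ x
matcher-correct σ l x m = substOf-agrees σ _ x (bindings-agree σ l) (bindings-cover σ l x m)

data RootStep (rs : List Rule) : Term → Term → Set where
  instance-of : ∀ {l r} (σ : ℕ → Term) → (l , r) ∈ rs → RootStep rs (subst σ l) (subst σ r)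

rootSuccessors : List Rule → Term → List Term
rootSuccessors [] t = []
rootSuccessors ((l , r) ∷ rs) t with subst (matcher l t) l ≟T t
... | yes _ = subst (matcher l t) r ∷ rootSuccessors rs t
... | no _ = rootSuccessors rs t

rootStep-there : ∀ {lr rs t u} → RootStep rs t u → RootStep (lr ∷ rs) t u
rootStep-there (instance-of σ mem) = instance-of σ (there mem)

rootSuccessors-sound : ∀ rs t u → u ∈ rootSuccessors rs t → RootStep rs t u
rootSuccessors-sound ((l , r) ∷ rs) t u m with subst (matcher l t) l ≟T t
rootSuccessors-sound ((l , r) ∷ rs) t u (here refl) | yes match =
  substEq (λ t' → RootStep ((l , r) ∷ rs) t' (subst (matcher l t) r)) match (instance-of (matcher l t) (here refl))
rootSuccessors-sound ((l , r) ∷ rs) t u (there m) | yes _ = rootStep-there (rootSuccessors-sound rs t u m)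
rootSuccessors-sound ((l , r) ∷ rs) t u m         | no _  = rootStep-there (rootSuccessors-sound rs t u m)

-- Completeness needs var(r) ⊆ var(l): only then is σ(r) determined by σ(l).
rootSuccessors-complete : ∀ rs σ l r → (l , r) ∈ rs → (∀ x → x ∈ vars r → x ∈ vars l) →
                          subst σ r ∈ rootSuccessors rs (subst σ l)
rootSuccessors-complete ((l , r) ∷ rs) σ .l .r (here refl) r⊆l
  with subst (matcher l (subst σ l)) l ≟T subst σ l
... | yes _ = here (sym (subst-agree _ σ r (λ x m → matcher-correct σ l x (r⊆l x m))))
... | no no-match = ⊥-elim (no-match (subst-agree _ σ l (matcher-correct σ l)))
rootSuccessors-complete ((l' , r') ∷ rs) σ l r (there mem) r⊆l
  with subst (matcher l' (subst σ l)) l' ≟T subst σ l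
... | yes _ = there (rootSuccessors-complete rs σ l r mem r⊆l)
... | no _ = rootSuccessors-complete rs σ l r mem r⊆l

module FiniteBranching (R : TRS) where

  mutual
    successors : Term → List Term
    successors t = rootSuccessors (rules R) t ++ innerSuccessors t

    innerSuccessors : Term → List Term
    innerSuccessors (var x) = []
    innerSuccessors (st ())
    innerSuccessors (app f ts) = map (app f) (argSuccessors ts)

    argSuccessors : ∀ {n} → Vec Term n → List (Vec Term n)
    argSuccessors [] = []
    argSuccessors (t ∷ ts) = map (_∷ ts) (successors t) ++ map (t ∷_) (argSuccessors ts)

  mutual
    successors-sound : ∀ {t u} → u ∈ successors t → Step R t u
    successors-sound {t} m with ∈-++⁻ (rootSuccessors (rules R) t) m
    ... | inj₂ m' = innerSuccessors-sound t m'
    ... | inj₁ m' with rootSuccessors-sound (rules R) t _ m'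
    ...   | instance-of σ mem = root σ mem

    innerSuccessors-sound : ∀ t {u} → u ∈ innerSuccessors t → Step R t u
    innerSuccessors-sound (st ()) m
    innerSuccessors-sound (app f ts) m with ∈-map⁻ (app f) m
    ... | us , m' , refl = arg f (argSuccessors-sound ts m')

    argSuccessors-sound : ∀ {n} (ts : Vec Term n) {us} → us ∈ argSuccessors ts → StepV R ts us
    argSuccessors-sound (t ∷ ts) m with ∈-++⁻ (map (_∷ ts) (successors t)) m
    ... | inj₁ m' with ∈-map⁻ (_∷ ts) m'
    ...   | u , m'' , refl = here (successors-sound m'')
    argSuccessors-sound (t ∷ ts) m | inj₂ m' with ∈-map⁻ (t ∷_) m'
    ...   | us , m'' , refl = there (argSuccessors-sound ts m'')

  mutual
    successors-complete : ∀ {t u} → Step R t u → u ∈ successors t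
    successors-complete (root {l} {r} σ mem) =
      ∈-++⁺ˡ (rootSuccessors-complete (rules R) σ l r mem (All.lookup (varCond R) mem))
    successors-complete (arg f {ts} steps) =
      ∈-++⁺ʳ (rootSuccessors (rules R) (app f ts)) (∈-map⁺ (app f) (argSuccessors-complete steps))

    argSuccessors-complete : ∀ {n} {ts us : Vec Term n} → StepV R ts us → us ∈ argSuccessors ts
    argSuccessors-complete (here {ts = ts} s) = ∈-++⁺ˡ (∈-map⁺ (_∷ ts) (successors-complete s))
    argSuccessors-complete (there {t = t} steps) = ∈-++⁺ʳ _ (∈-map⁺ (t ∷_) (argSuccessors-complete steps))

module Reachability {A : Set} (_⟶_ : A → A → Set) (next : A → List A)
                    (next-sound : ∀ {t u} → u ∈ next t → t ⟶ u)
                    (next-complete : ∀ {t u} → t ⟶ u → u ∈ next t) where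

  reachable : ∀ t → Acc (flip _⟶_) t → List A
  reachable t (acc rs) = t ∷ concat (mapWith∈ (next t) (λ {u} u∈ → reachable u (rs (next-sound u∈))))

  reachable-sound : ∀ t a {u} → u ∈ reachable t a → Star _⟶_ t u
  reachable-sound t (acc rs) (here refl) = ε
  reachable-sound t (acc rs) (there m) with AnyP.mapWith∈⁻ (next t) _ (AnyP.concat⁻ _ m)
  ... | v , v∈ , m' = next-sound v∈ ◅ reachable-sound v _ m'

  reachable-complete : ∀ t a {u} → Star _⟶_ t u → u ∈ reachable t a
  reachable-complete t (acc rs) ε = here refl
  reachable-complete t (acc rs) (s ◅ ss) =
    there (AnyP.concat⁺ (AnyP.mapWith∈⁺ _ (_ , next-complete s , reachable-complete _ _ ss)))

  module _ (wf : WellFounded (flip _⟶_)) where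

    reachableFrom : List A → List A
    reachableFrom L = concatMap (λ q → reachable q (wf q)) L

    reachableFrom-correct : ∀ L u → u ∈ reachableFrom L ⇔ (∃ λ q → q ∈ L × Star _⟶_ q u)
    reachableFrom-correct L u = mk⇔ sound complete
      where
      sound : u ∈ reachableFrom L → ∃ λ q → q ∈ L × Star _⟶_ q u
      sound m with find (∈-concatMap⁻ (λ q → reachable q (wf q)) {xs = L} m)
      ... | q , q∈L , m' = q , q∈L , reachable-sound q (wf q) m'

      complete : (∃ λ q → q ∈ L × Star _⟶_ q u) → u ∈ reachableFrom L
      complete (q , q∈L , steps) =
        ∈-concatMap⁺ (λ q → reachable q (wf q)) (Any.map (λ { refl → reachable-complete q (wf q) steps }) q∈L)

module Ground (Σ' : RankedAlphabet) where

  mutual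
    data Gnd : Term → Set where
      gapp : ∀ {f ts} → f ∈ Σ' → GndV ts → Gnd (app f ts)

    data GndV : ∀ {n} → Vec Term n → Set where
      [] : GndV []
      _∷_ : ∀ {n t} {ts : Vec Term n} → Gnd t → GndV ts → GndV (t ∷ ts)

  mutual
    gnd-vars : ∀ {t} → Gnd t → vars t ≡ []
    gnd-vars (gapp _ gs) = gndV-vars gs

    gndV-vars : ∀ {n} {ts : Vec Term n} → GndV ts → varsV ts ≡ []
    gndV-vars [] = refl
    gndV-vars (g ∷ gs) = cong₂ _++_ (gnd-vars g) (gndV-vars gs)

  mutual
    gnd-syms : ∀ {t f} → Gnd t → f ∈ syms t → f ∈ Σ'
    gnd-syms (gapp f∈Σ _) (here refl) = f∈Σ
    gnd-syms (gapp _ gs) (there m) = gndV-syms gs m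

    gndV-syms : ∀ {n f} {ts : Vec Term n} → GndV ts → f ∈ symsV ts → f ∈ Σ'
    gndV-syms (_∷_ {t = t} g gs) m with ∈-++⁻ (syms t) m
    ... | inj₁ m' = gnd-syms g m'
    ... | inj₂ m' = gndV-syms gs m'

  gnd⇒groundOver : ∀ {t} → Gnd t → GroundOver Σ' t
  gnd⇒groundOver g = gnd-vars g , λ f m → gnd-syms g m

  mutual
    groundOver⇒gnd : ∀ t → vars t ≡ [] → (∀ f → f ∈ syms t → f ∈ Σ') → Gnd t
    groundOver⇒gnd (st ()) _ _
    groundOver⇒gnd (app f ts) noVars sym⊆Σ =
      gapp (sym⊆Σ f (here refl)) (groundOver⇒gndV ts noVars (λ g m → sym⊆Σ g (there m)))

    groundOver⇒gndV : ∀ {n} (ts : Vec Term n) → varsV ts ≡ [] → (∀ f → f ∈ symsV ts → f ∈ Σ') → GndV ts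
    groundOver⇒gndV [] _ _ = []
    groundOver⇒gndV (t ∷ ts) noVars sym⊆Σ =
      groundOver⇒gnd t (++-conicalˡ (vars t) _ noVars) (λ f m → sym⊆Σ f (∈-++⁺ˡ m))
      ∷ groundOver⇒gndV ts (++-conicalʳ (vars t) _ noVars) (λ f m → sym⊆Σ f (∈-++⁺ʳ (syms t) m))

  mutual
    gnd-subst-var : ∀ σ l x → Gnd (subst σ l) → x ∈ vars l → Gnd (σ x)
    gnd-subst-var σ (var y) x g (here refl) = g
    gnd-subst-var σ (st ()) x g m
    gnd-subst-var σ (app f ls) x (gapp _ gs) m = gndV-subst-var σ ls x gs m

    gndV-subst-var : ∀ {n} σ (ls : Vec Term n) x → GndV (substV σ ls) → x ∈ varsV ls → Gnd (σ x)
    gndV-subst-var σ (l ∷ ls) x (g ∷ gs) m with ∈-++⁻ (vars l) m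
    ... | inj₁ m' = gnd-subst-var σ l x g m'
    ... | inj₂ m' = gndV-subst-var σ ls x gs m'

  mutual
    gnd-subst : ∀ σ r → (∀ f → f ∈ syms r → f ∈ Σ') → (∀ x → x ∈ vars r → Gnd (σ x)) → Gnd (subst σ r)
    gnd-subst σ (var x) _ σ-gnd = σ-gnd x (here refl)
    gnd-subst σ (st ())
    gnd-subst σ (app f rs) sym⊆Σ σ-gnd =
      gapp (sym⊆Σ f (here refl)) (gndV-subst σ rs (λ g m → sym⊆Σ g (there m)) σ-gnd)

    gndV-subst : ∀ {n} σ (rs : Vec Term n) → (∀ f → f ∈ symsV rs → f ∈ Σ') → (∀ x → x ∈ varsV rs → Gnd (σ x)) → GndV (substV σ rs)
    gndV-subst σ [] _ _ = []
    gndV-subst σ (r ∷ rs) sym⊆Σ σ-gnd =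
      gnd-subst σ r (λ f m → sym⊆Σ f (∈-++⁺ˡ m)) (λ x m → σ-gnd x (∈-++⁺ˡ m))
      ∷ gndV-subst σ rs (λ f m → sym⊆Σ f (∈-++⁺ʳ (syms r) m)) (λ x m → σ-gnd x (∈-++⁺ʳ (vars r) m))

  rhs-syms⊆sign : ∀ rs {l r f} → (l , r) ∈ rs → f ∈ syms r → f ∈ signRules rs
  rhs-syms⊆sign ((l , r) ∷ rs) (here refl) m = ∈-++⁺ʳ (syms l) (∈-++⁺ˡ m)
  rhs-syms⊆sign ((l' , r') ∷ rs) (there mem) m = ∈-++⁺ʳ (syms l') (∈-++⁺ʳ (syms r') (rhs-syms⊆sign rs mem m))

  module _ (R : TRS) (sign⊆Σ : ∀ f → f ∈ sign R → f ∈ Σ') where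

    mutual
      gnd-step : ∀ {t u} → Gnd t → Step R t u → Gnd u
      gnd-step g (root {l} {r} σ mem) =
        gnd-subst σ r (λ f m → sign⊆Σ f (rhs-syms⊆sign (rules R) mem m))
                      (λ x m → gnd-subst-var σ l x g (All.lookup (varCond R) mem x m))
      gnd-step (gapp f∈Σ gs) (arg f steps) = gapp f∈Σ (gndV-step gs steps)

      gndV-step : ∀ {n} {ts us : Vec Term n} → GndV ts → StepV R ts us → GndV us
      gndV-step (g ∷ gs) (here s) = gnd-step g s ∷ gs
      gndV-step (g ∷ gs) (there steps) = g ∷ gndV-step gs steps

    gnd-steps : ∀ {t u} → Gnd t → Steps R t u → Gnd u
    gnd-steps g ε = g
    gnd-steps g (s ◅ ss) = gnd-steps (gnd-step g s) ss

-- The states are the subterms of D; state q stands for the term termOf q,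
-- and the automaton only ever rewrites a term into a state standing for it.

module FiniteLanguage (Σ' : RankedAlphabet) (D : List Term) (D-gnd : ∀ {t} → t ∈ D → Ground.Gnd Σ' t) where
  open Ground Σ'

  mutual
    subterms : Term → List Term
    subterms (var x) = var x ∷ []
    subterms (st ())
    subterms (app f ts) = app f ts ∷ subtermsV ts

    subtermsV : ∀ {n} → Vec Term n → List Term
    subtermsV [] = []
    subtermsV (t ∷ ts) = subterms t ++ subtermsV ts

  stateTerms : List Term
  stateTerms = concatMap subterms D

  nStates : ℕ
  nStates = length stateTerms

  State : Set
  State = Fin nStates

  termOf : State → Term
  termOf = lookup stateTerms

  stateOf : Term → Maybe State
  stateOf t with Any.any? (t ≟T_) stateTerms
  ... | yes t∈ = just (Any.index t∈)
  ... | no _ = nothing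

  stateOf-sound : ∀ {t q} → stateOf t ≡ just q → termOf q ≡ t
  stateOf-sound {t} found with Any.any? (t ≟T_) stateTerms
  stateOf-sound refl | yes t∈ = sym (AnyP.lookup-index t∈)
  stateOf-sound () | no _

  stateOf-complete : ∀ {t} → t ∈ stateTerms → ∃ λ q → stateOf t ≡ just q
  stateOf-complete {t} t∈ with Any.any? (t ≟T_) stateTerms
  ... | yes t∈' = Any.index t∈' , refl
  ... | no t∉ = ⊥-elim (t∉ t∈)

  statesOf : ∀ {k} → Vec Term k → Maybe (Vec State k)
  statesOf [] = just []
  statesOf (t ∷ ts) with stateOf t | statesOf ts
  ... | just q | just qs = just (q ∷ qs)
  ... | _ | _ = nothing

  mutual
    unfold : Tm State → Term
    unfold (var x) = var x
    unfold (st q) = termOf q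
    unfold (app f ts) = app f (unfoldV ts)

    unfoldV : ∀ {k} → Vec (Tm State) k → Vec Term k
    unfoldV [] = []
    unfoldV (t ∷ ts) = unfold t ∷ unfoldV ts

  mutual
    unfold-ι : ∀ t → unfold (ι t) ≡ t
    unfold-ι (var x) = refl
    unfold-ι (st ())
    unfold-ι (app f ts) = cong (app f) (unfoldV-ιV ts)

    unfoldV-ιV : ∀ {k} (ts : Vec Term k) → unfoldV (ιV ts) ≡ ts
    unfoldV-ιV [] = refl
    unfoldV-ιV (t ∷ ts) = cong₂ _∷_ (unfold-ι t) (unfoldV-ιV ts)

  statesOf-sound : ∀ {k} (ts : Vec Term k) {qs} → statesOf ts ≡ just qs → unfoldV (stV qs) ≡ ts
  statesOf-sound [] refl = refl
  statesOf-sound (t ∷ ts) found with stateOf t in e₁ | statesOf ts in e₂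
  statesOf-sound (t ∷ ts) refl | just q | just qs = cong₂ _∷_ (stateOf-sound e₁) (statesOf-sound ts e₂)
  statesOf-sound (t ∷ ts) () | just q | nothing
  statesOf-sound (t ∷ ts) () | nothing | _

  ΣRule : Set
  ΣRule = Σ (DeltaRule nStates) (λ d → proj₁ d ∈ Σ')

  ruleFor : State → Term → List ΣRule
  ruleFor q (app f args) with Any.any? (f ≟S_) Σ' | statesOf args
  ... | yes f∈Σ | just qs = ((f , qs , q) , f∈Σ) ∷ []
  ... | _ | _ = []
  ruleFor q _ = []

  allRules : List ΣRule
  allRules = concatMap (λ q → ruleFor q (termOf q)) (allFin nStates)

  isFinal? : (q : State) → Dec (termOf q ∈ D)
  isFinal? q = Any.any? (termOf q ≟T_) D

  C : BTA Σ'
  C = record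
    { nstates = nStates
    ; final   = filter isFinal? (allFin nStates)
    ; δrules  = map proj₁ allRules
    ; δinΣ    = AllP.map⁺ (All.tabulate (λ {e} _ → proj₂ e))
    ; εrules  = []
    }

  Unfolds : DeltaRule nStates → Set
  Unfolds (f , qs , q) = termOf q ≡ app f (unfoldV (stV qs))

  ruleFor-unfolds : ∀ q t → termOf q ≡ t → All (λ e → Unfolds (proj₁ e)) (ruleFor q t)
  ruleFor-unfolds q (var x) _ = []
  ruleFor-unfolds q (st ())
  ruleFor-unfolds q (app f args) q↦t with Any.any? (f ≟S_) Σ' | statesOf args in found
  ... | yes _ | just qs = trans q↦t (cong (app f) (sym (statesOf-sound args found))) ∷ []
  ... | yes _ | nothing = []
  ... | no _  | _ = []

  δrule-unfolds : ∀ {d} → d ∈ δrules C → Unfolds d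
  δrule-unfolds m with ∈-map⁻ proj₁ m
  ... | e , e∈ , refl with find (∈-concatMap⁻ (λ q → ruleFor q (termOf q)) {xs = allFin nStates} e∈)
  ...   | q , _ , e∈q = All.lookup (ruleFor-unfolds q (termOf q) refl) e∈q

  ruleFor-complete : ∀ q f args qs → f ∈ Σ' → statesOf args ≡ just qs →
                     ∃ λ f∈Σ → ((f , qs , q) , f∈Σ) ∈ ruleFor q (app f args)
  ruleFor-complete q f args qs f∈Σ found with Any.any? (f ≟S_) Σ' | statesOf args | found
  ... | yes f∈Σ' | just .qs | refl = f∈Σ' , here refl
  ... | yes _    | nothing  | ()
  ... | no f∉Σ   | _ | _ = ⊥-elim (f∉Σ f∈Σ)

  δrule-complete : ∀ {q f args qs} → termOf q ≡ app f args → f ∈ Σ' → statesOf args ≡ just qs →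
                   (f , qs , q) ∈ δrules C
  δrule-complete {q} {f} {args} {qs} q↦t f∈Σ found with ruleFor-complete q f args qs f∈Σ found
  ... | f∈Σ' , rule∈ =
    ∈-map⁺ proj₁ (∈-concatMap⁺ (λ q → ruleFor q (termOf q))
      (Any.map (λ { refl → substEq (λ t → ((f , qs , q) , f∈Σ') ∈ ruleFor q t) (sym q↦t) rule∈ }) (∈-allFin q)))

  mutual
    move-unfold : ∀ {u v} → Move C u v → unfold u ≡ unfold v
    move-unfold (δmove m) = sym (δrule-unfolds m)
    move-unfold (εmove ())
    move-unfold (arg f mv) = cong (app f) (moveV-unfold mv)

    moveV-unfold : ∀ {k} {ts us : Vec (Tm State) k} → MoveV C ts us → unfoldV ts ≡ unfoldV us
    moveV-unfold (here m) = cong₂ _∷_ (move-unfold m) refl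
    moveV-unfold (there mv) = cong₂ _∷_ refl (moveV-unfold mv)

  moves-unfold : ∀ {u v} → Star (Move C) u v → unfold u ≡ unfold v
  moves-unfold ε = refl
  moves-unfold (m ◅ ms) = trans (move-unfold m) (moves-unfold ms)

  mutual
    run : ∀ t → Gnd t → (∀ {s} → s ∈ subterms t → s ∈ stateTerms) →
          ∃ λ q → stateOf t ≡ just q × Star (Move C) (ι t) (st q)
    run (app f args) (gapp f∈Σ gs) sub with runV args gs (λ m → sub (there m)) | stateOf-complete (sub (here refl))
    ... | qs , found , args↦qs | q , e =
      q , e , (gmap (app f) (arg f) args↦qs ◅◅ (δmove (δrule-complete (stateOf-sound e) f∈Σ found) ◅ ε))

    runV : ∀ {k} (args : Vec Term k) → GndV args → (∀ {s} → s ∈ subtermsV args → s ∈ stateTerms) →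
           ∃ λ qs → statesOf args ≡ just qs × Star (MoveV C) (ιV args) (stV qs)
    runV [] [] _ = [] , refl , ε
    runV (t ∷ ts) (g ∷ gs) sub with run t g (λ m → sub (∈-++⁺ˡ m)) | runV ts gs (λ m → sub (∈-++⁺ʳ (subterms t) m))
    ... | q , e , t↦q | qs , e' , ts↦qs =
      q ∷ qs , found e e' , (gmap (_∷ ιV ts) here t↦q ◅◅ gmap (st q ∷_) there ts↦qs)
      where
      found : stateOf t ≡ just q → statesOf ts ≡ just qs → statesOf (t ∷ ts) ≡ just (q ∷ qs)
      found e e' rewrite e | e' = refl

  recognises : ∀ t → Lang C t ⇔ t ∈ D
  recognises t = mk⇔ sound complete
    where
    sound : Lang C t → t ∈ D
    sound (_ , q , q-final , t↦q) with trans (sym (unfold-ι t)) (moves-unfold t↦q)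
    ... | refl = proj₂ (∈-filter⁻ isFinal? {xs = allFin nStates} q-final)

    complete : t ∈ D → Lang C t
    complete t∈D with run t (D-gnd t∈D) (λ s∈ → ∈-concatMap⁺ subterms (Any.map (λ { refl → s∈ }) t∈D))
    ... | q , e , t↦q =
      gnd⇒groundOver (D-gnd t∈D) , q ,
      ∈-filter⁺ isFinal? (∈-allFin q) (substEq (_∈ D) (sym (stateOf-sound e)) t∈D) , t↦q

mainTheorem11 : (R : TRS) → Terminating R → EPRF R
mainTheorem11 R terminating Σ' sign⊆Σ L L-ground =
  FiniteLanguage.C Σ' D D-gnd , λ t → ⇔-trans (FiniteLanguage.recognises Σ' D D-gnd t) (descendants t)
  where
  open FiniteBranching R
  open Reachability (Step R) successors successors-sound successors-complete
  open Ground Σ'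

  D : List Term
  D = reachableFrom terminating L

  descendants : ∀ t → t ∈ D ⇔ Descendants R L t
  descendants = reachableFrom-correct terminating L

  D-gnd : ∀ {t} → t ∈ D → Gnd t
  D-gnd t∈D with Equivalence.to (descendants _) t∈D
  ... | q , q∈L , steps =
    let (noVars , sym⊆Σ) = All.lookup L-ground q∈L
    in gnd-steps R sign⊆Σ (groundOver⇒gnd q noVars sym⊆Σ) steps
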